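{- Let $n,d\ge 1$ be integers and $\mathbb{F}$ a field with at least $d(n-1)+1$ elements. Then $\operatorname{rank}_{\mathbb{F}}(T_{\mathbb{Z}_n}^d)\le d(n-1)+1$.
   Context: $T_{\mathbb{Z}_n}^d:\mathbb{Z}_n^d\to\mathbb{F}$ is defined by $T(g_1,\ldots,g_d)=1$ if $g_1+\cdots+g_d\equiv 0\pmod n$ and $0$ otherwise. A tensor is simple if $T(g_1,\ldots,g_d)=\prod_j\vec v_j(g_j)$; rank is the minimum number of simple tensors summing to $T$. -}

module Defs where

open import Level using (Level; suc; _⊔_)
open import Data.Nat using (ℕ; NonZero)
open import Data.Nat.DivMod using (_%_)
open import Data.Fin using (Fin; toℕ)
open import Data.Product using (Σ; ∃; _×_; _,_)
open import Data.Vec.Functional using (Vector; foldr)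
open import Algebra.Bundles using (CommutativeRing)
open import Relation.Binary.PropositionalEquality using (_≡_)
open import Relation.Nullary using (¬_; Dec; yes; no)

record Field (c ℓ : Level) : Set (suc (c ⊔ ℓ)) where
  field
    commutativeRing : CommutativeRing c ℓ
  open CommutativeRing commutativeRing public
  field
    1≉0     : ¬ (1# ≈ 0#)
    inverse : ∀ x → ¬ (x ≈ 0#) → Σ Carrier λ y → (x * y) ≈ 1#

module _ {c ℓ : Level} (F : Field c ℓ) where
  open Field F

  HasAtLeast : ℕ → Set (c ⊔ ℓ)
  HasAtLeast m = Σ (Fin m → Carrier) λ x → ∀ i j → x i ≈ x j → i ≡ j

  ∑ : ∀ {m} → Vector Carrier m → Carrier
  ∑ = foldr _+_ 0#

  ∏ : ∀ {m} → Vector Carrier m → Carrier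
  ∏ = foldr _*_ 1#

  -- d-tensors over the group ℤ_n (elements represented by Fin n)
  Tensor : ℕ → ℕ → Set c
  Tensor n d = (Fin d → Fin n) → Carrier

  simple : ∀ {n d} → (Fin d → Fin n → Carrier) → Tensor n d
  simple v g = ∏ (λ j → v j (g j))

  RankAtMost : ∀ {n d} → Tensor n d → ℕ → Set (c ⊔ ℓ)
  RankAtMost {n} {d} T r =
    Σ ℕ λ m → (m Data.Nat.≤ r) ×
      Σ (Fin m → Fin d → Fin n → Carrier) λ v →
        ∀ g → T g ≈ ∑ (λ k → simple (v k) g)

  sumℕ : ∀ {d n} → (Fin d → Fin n) → ℕ
  sumℕ g = foldr Data.Nat._+_ 0 (λ j → toℕ (g j))

  T-ℤ : (n d : ℕ) → .{{NonZero n}} → Tensor n d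
  T-ℤ n d g with (sumℕ g % n) Data.Nat.≟ 0
  ... | yes _ = 1#
  ... | no _  = 0#

-- With M = d(n−1)+1 distinct nodes aₖ, the rows g ↦ aₖ^g (one of them scaled by cₖ) form a simple
-- tensor with value cₖ aₖ^(g₁+⋯+g_d). Since T(g) depends only on s = g₁+⋯+g_d ∈ [0, M), it suffices
-- to choose the cₖ so that ∑ₖ cₖ aₖˢ equals the indicator of n ∣ s for every s < M: a transposed
-- Vandermonde system, solvable because the nodes are distinct.
module Submission where

open import Defs
open import Level using (Level)
open import Data.Maybe using (nothing)
import Data.Nat as ℕ
open ℕ using (ℕ; zero; suc; _≤_; _<_; z≤n; s≤s; NonZero)
import Data.Nat.Properties as ℕₚ
open import Data.Fin using (Fin; toℕ) renaming (zero to fzero; suc to fsuc)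
open import Data.Fin.Properties using (toℕ<n; suc-injective)
open import Data.Product using (Σ; _,_; proj₁; proj₂)
open import Data.Vec.Functional using (foldr)
open import Relation.Nullary using (¬_; yes; no)
open import Relation.Binary.PropositionalEquality as ≡ using (_≡_)
import Algebra.Solver.Ring.NaturalCoefficients
import Algebra.Properties.Group
import Algebra.Properties.Semiring.Exp
import Algebra.Properties.Semiring.Sum

module _ {c ℓ : Level} (F : Field c ℓ) where
  open Field F
  open Algebra.Properties.Group +-group using (x∙y⁻¹≈ε⇒x≈y; //-rightDividesˡ)
  open Algebra.Properties.Semiring.Exp semiring using (_^_; ^-homo-*)
  open Algebra.Properties.Semiring.Sum semiring using (sum-cong-≋; ∑-distrib-+; *-distribˡ-sum)
  open Algebra.Solver.Ring.NaturalCoefficients commutativeSemiring (λ _ _ → nothing)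
    using (solve; _:=_; _:+_; _:*_)
  open import Relation.Binary.Reasoning.Setoid setoid

  difference-invertible : ∀ {x y} → ¬ x ≈ y → Σ Carrier λ z → (x - y) * z ≈ 1#
  difference-invertible x≉y = inverse _ (λ x-y≈0 → x≉y (x∙y⁻¹≈ε⇒x≈y _ _ x-y≈0))

  recurrence-unique : ∀ N x (e u v : ℕ → Carrier) → u 0 ≈ v 0 →
    (∀ s → s < N → u (suc s) ≈ x * u s + e s) → (∀ s → s < N → v (suc s) ≈ x * v s + e s) →
    ∀ s → s ≤ N → u s ≈ v s
  recurrence-unique N x e u v u₀≈v₀ u-rec v-rec zero _ = u₀≈v₀
  recurrence-unique N x e u v u₀≈v₀ u-rec v-rec (suc s) s<N = begin
    u (suc s)   ≈⟨ u-rec s s<N ⟩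
    x * u s + e s ≈⟨ +-congʳ (*-congˡ (recurrence-unique N x e u v u₀≈v₀ u-rec v-rec s (ℕₚ.<⇒≤ s<N))) ⟩
    x * v s + e s ≈⟨ v-rec s s<N ⟨
    v (suc s)   ∎

  powerSum : ∀ {N} → (Fin N → Carrier) → (Fin N → Carrier) → ℕ → Carrier
  powerSum c a s = ∑ F (λ i → c i * a i ^ s)

  powerSum-shift : ∀ {N} x (c a y : Fin N → Carrier) → (∀ i → (a i - x) * y i ≈ 1#) → ∀ s →
    powerSum (λ i → c i * y i) a (suc s) ≈ x * powerSum (λ i → c i * y i) a s + powerSum c a s
  powerSum-shift x c a y inv s = begin
    powerSum (λ i → c i * y i) a (suc s)
      ≈⟨ sum-cong-≋ term ⟩
    ∑ F (λ i → x * (c i * y i * a i ^ s) + c i * a i ^ s)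
      ≈⟨ ∑-distrib-+ (λ i → x * (c i * y i * a i ^ s)) (λ i → c i * a i ^ s) ⟩
    ∑ F (λ i → x * (c i * y i * a i ^ s)) + powerSum c a s
      ≈⟨ +-congʳ (*-distribˡ-sum x (λ i → c i * y i * a i ^ s)) ⟨
    x * powerSum (λ i → c i * y i) a s + powerSum c a s ∎
    where
    term : ∀ i → c i * y i * a i ^ suc s ≈ x * (c i * y i * a i ^ s) + c i * a i ^ s
    term i = begin
      c i * y i * (a i * a i ^ s)
        ≈⟨ *-congˡ (*-congʳ (//-rightDividesˡ x (a i))) ⟨
      c i * y i * ((a i - x + x) * a i ^ s)
        ≈⟨ solve 5 (λ c y d x p → c :* y :* ((d :+ x) :* p) := x :* (c :* y :* p) :+ c :* p :* (d :* y))
                   refl (c i) (y i) (a i - x) x (a i ^ s) ⟩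
      x * (c i * y i * a i ^ s) + c i * a i ^ s * ((a i - x) * y i)
        ≈⟨ +-congˡ (trans (*-congˡ (inv i)) (*-identityʳ _)) ⟩
      x * (c i * y i * a i ^ s) + c i * a i ^ s ∎

  -- Peeling off the node a₀: the differences Δf(s) = f(s+1) − a₀ f(s) are interpolated on the other
  -- nodes, and dividing by aᵢ − a₀ turns this into a solution h of the recurrence f obeys,
  -- h(s+1) = a₀ h(s) + Δf(s); adding a multiple of a₀ˢ then matches the initial value f(0).
  vandermonde-solvable : ∀ {N} (a : Fin N → Carrier) → (∀ i j → a i ≈ a j → i ≡ j) → (f : ℕ → Carrier) →
    Σ (Fin N → Carrier) λ c → ∀ s → s < N → powerSum c a s ≈ f s
  vandermonde-solvable {zero} a _ f = (λ ()) , λ _ ()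
  vandermonde-solvable {suc N} a distinct f
    with vandermonde-solvable (λ i → a (fsuc i)) (λ i j e → suc-injective (distinct _ _ e))
                              (λ s → f (suc s) - a fzero * f s)
  ... | c′ , c′-solves = coeffs , solves
    where
    x : Carrier
    x = a fzero
    b : Fin N → Carrier
    b i = a (fsuc i)
    Δf : ℕ → Carrier
    Δf s = f (suc s) - x * f s
    b≉x : ∀ i → ¬ b i ≈ x
    b≉x i bi≈x with distinct (fsuc i) fzero bi≈x
    ... | ()
    y : Fin N → Carrier
    y i = proj₁ (difference-invertible (b≉x i))
    h : ℕ → Carrier
    h = powerSum (λ i → c′ i * y i) b
    h-recurrence : ∀ s → s < N → h (suc s) ≈ x * h s + Δf s
    h-recurrence s s<N = trans (powerSum-shift x c′ b y (λ i → proj₂ (difference-invertible (b≉x i))) s)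
                               (+-congˡ (c′-solves s s<N))
    coeffs : Fin (suc N) → Carrier
    coeffs fzero = f 0 - h 0
    coeffs (fsuc i) = c′ i * y i
    g : ℕ → Carrier
    g = powerSum coeffs a
    g-recurrence : ∀ s → s < N → g (suc s) ≈ x * g s + Δf s
    g-recurrence s s<N = begin
      coeffs fzero * (x * x ^ s) + h (suc s)        ≈⟨ +-congˡ (h-recurrence s s<N) ⟩
      coeffs fzero * (x * x ^ s) + (x * h s + Δf s)
        ≈⟨ solve 5 (λ u x p h e → u :* (x :* p) :+ (x :* h :+ e) := x :* (u :* p :+ h) :+ e)
                   refl (coeffs fzero) x (x ^ s) (h s) (Δf s) ⟩
      x * g s + Δf s                                ∎
    f-recurrence : ∀ s → s < N → f (suc s) ≈ x * f s + Δf s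
    f-recurrence s _ = sym (trans (+-comm _ _) (//-rightDividesˡ (x * f s) (f (suc s))))
    solves : ∀ s → s < suc N → g s ≈ f s
    solves s (s≤s s≤N) = recurrence-unique N x Δf g f
      (trans (+-congʳ (*-identityʳ _)) (//-rightDividesˡ (h 0) (f 0))) g-recurrence f-recurrence s s≤N

  ∏-^ : ∀ {d} x (m : Fin d → ℕ) → ∏ F (λ j → x ^ m j) ≈ x ^ foldr ℕ._+_ 0 m
  ∏-^ {zero} x m = refl
  ∏-^ {suc d} x m = begin
    x ^ m fzero * ∏ F (λ j → x ^ m (fsuc j))       ≈⟨ *-congˡ (∏-^ x (λ j → m (fsuc j))) ⟩
    x ^ m fzero * x ^ foldr ℕ._+_ 0 (λ j → m (fsuc j)) ≈⟨ ^-homo-* x (m fzero) _ ⟨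
    x ^ foldr ℕ._+_ 0 m ∎

  scaledPowers : ∀ {d n} → Carrier → Carrier → Fin (suc d) → Fin n → Carrier
  scaledPowers e x fzero    h = e * x ^ toℕ h
  scaledPowers e x (fsuc j) h = x ^ toℕ h

  simple-scaledPowers : ∀ {d n} e x (g : Fin (suc d) → Fin n) →
    simple F (scaledPowers e x) g ≈ e * x ^ sumℕ F g
  simple-scaledPowers e x g = begin
    e * x ^ toℕ (g fzero) * ∏ F (λ j → x ^ toℕ (g (fsuc j))) ≈⟨ *-congˡ (∏-^ x (λ j → toℕ (g (fsuc j)))) ⟩
    e * x ^ toℕ (g fzero) * x ^ sumℕ F (λ j → g (fsuc j))    ≈⟨ *-assoc _ _ _ ⟩
    e * (x ^ toℕ (g fzero) * x ^ sumℕ F (λ j → g (fsuc j)))  ≈⟨ *-congˡ (^-homo-* x (toℕ (g fzero)) _) ⟨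
    e * x ^ sumℕ F g ∎

  multipleIndicator : (n : ℕ) .{{_ : NonZero n}} → ℕ → Carrier
  multipleIndicator n s with s ℕ.% n ℕ.≟ 0
  ... | yes _ = 1#
  ... | no _  = 0#

  T-ℤ≡multipleIndicator∘sumℕ : ∀ n d .{{_ : NonZero n}} (g : Fin d → Fin n) →
    T-ℤ F n d g ≡ multipleIndicator n (sumℕ F g)
  T-ℤ≡multipleIndicator∘sumℕ n d g with sumℕ F g ℕ.% n ℕ.≟ 0
  ... | yes _ = ≡.refl
  ... | no _  = ≡.refl

  sumℕ≤d*[n∸1] : ∀ {n} d (g : Fin d → Fin n) → sumℕ F g ≤ d ℕ.* (n ℕ.∸ 1)
  sumℕ≤d*[n∸1] zero    g = z≤n
  sumℕ≤d*[n∸1] (suc d) g = ℕₚ.+-mono-≤ (ℕₚ.∸-monoˡ-≤ 1 (toℕ<n (g fzero))) (sumℕ≤d*[n∸1] d (λ j → g (fsuc j)))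

  RankAtMost-cong : ∀ {n d r} {T T′ : Tensor F n d} → (∀ g → T g ≈ T′ g) → RankAtMost F T′ r → RankAtMost F T r
  RankAtMost-cong T≈T′ (m , m≤r , v , T′≈∑) = m , m≤r , v , λ g → trans (T≈T′ g) (T′≈∑ g)

  powerSum∘sumℕ-rankAtMost : ∀ {M d n} (c a : Fin M → Carrier) →
    RankAtMost F {n} {suc d} (λ g → powerSum c a (sumℕ F g)) M
  powerSum∘sumℕ-rankAtMost c a = _ , ℕₚ.≤-refl , (λ k → scaledPowers (c k) (a k)) ,
    λ g → sum-cong-≋ (λ k → sym (simple-scaledPowers (c k) (a k) g))

open import Data.Nat using (_+_; _*_; _∸_; _≥_)

corollary6p8 : {c ℓ : Level} (F : Field c ℓ) (n d : ℕ) .{{_ : NonZero n}} →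
    d ≥ 1 → HasAtLeast F (d * (n ∸ 1) + 1) →
    RankAtMost F (T-ℤ F n d) (d * (n ∸ 1) + 1)
corollary6p8 F n zero ()
corollary6p8 F n (suc d) _ (a , distinct) with vandermonde-solvable F a distinct (multipleIndicator F n)
... | coeffs , interpolates = RankAtMost-cong F T≈powerSum (powerSum∘sumℕ-rankAtMost F coeffs a)
  where
  open Field F using (_≈_)
  open import Relation.Binary.Reasoning.Setoid (Field.setoid F)
  T≈powerSum : ∀ g → T-ℤ F n (suc d) g ≈ powerSum F coeffs a (sumℕ F g)
  T≈powerSum g = begin
    T-ℤ F n (suc d) g                ≡⟨ T-ℤ≡multipleIndicator∘sumℕ F n (suc d) g ⟩
    multipleIndicator F n (sumℕ F g) ≈⟨ interpolates (sumℕ F g) sum<M ⟨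
    powerSum F coeffs a (sumℕ F g)   ∎
    where
    sum<M : sumℕ F g < suc d * (n ∸ 1) + 1
    sum<M = ℕₚ.≤-<-trans (sumℕ≤d*[n∸1] F (suc d) g) (ℕₚ.m<m+n _ ℕₚ.0<1+n)
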